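{- For $n \geq 3$, $a(n,1) = a(n-1,1) + n - 1$.
   Context: $A_n$ is the alternating group on $\{1,\dots,n\}$. Set $T(A_n) = \{(1\,2)(i\,j) \mid 1 \le i<j \le n\}$, a generating set of $A_n$. The length $\ell_{T(A_n)}(v)$ of $v \in A_n$ is the minimal $k \geq 0$ such that $v$ is a product of $k$ elements of $T(A_n)$. Let $a(n,m) = |\{v \in A_n \mid \ell_{T(A_n)}(v) = m\}|$. -}

module Defs where

open import Data.Nat using (ℕ; zero; suc; _+_; _<ᵇ_)
open import Data.Nat.Properties using ()
open import Data.Bool using (Bool; true; false; _∧_; _∨_; not; if_then_else_)
open import Data.Fin using (Fin; toℕ) renaming (zero to 0F; suc to sucF)
open import Data.Fin.Properties using () renaming (_≟_ to _≟F_)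
open import Data.Vec using (Vec; []; _∷_; lookup; tabulate)
open import Data.Vec.Properties using (≡-dec)
open import Data.List as L using (List; []; _∷_; map; concatMap; upTo)
open import Data.Bool.ListAction using (any; all)
open import Data.Product using (_×_; _,_)
open import Relation.Nullary.Decidable using (⌊_⌋)

-- A map {1,…,n} → {1,…,n} in one-line notation: entry x is v(x).
-- Points 1,…,n are represented by Fin n (point k ↦ index k-1).
Perm : ℕ → Set
Perm n = Vec (Fin n) n

_==_ : ∀ {n} → Perm n → Perm n → Bool
u == v = ⌊ ≡-dec _≟F_ u v ⌋

_∘ₚ_ : ∀ {n} → Perm n → Perm n → Perm n
σ ∘ₚ τ = tabulate (λ x → lookup σ (lookup τ x))

idₚ : ∀ {n} → Perm n
idₚ = tabulate (λ x → x)

swap : ∀ {n} → Fin n → Fin n → Perm n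
swap i j = tabulate (λ x → if ⌊ x ≟F i ⌋ then j else (if ⌊ x ≟F j ⌋ then i else x))

finList : (n : ℕ) → List (Fin n)
finList n = L.tabulate (λ x → x)

allVecs : (n k : ℕ) → List (Vec (Fin n) k)
allVecs n zero = [] ∷ []
allVecs n (suc k) = concatMap (λ x → map (x ∷_) (allVecs n k)) (finList n)

pairsLt : (n : ℕ) → List (Fin n × Fin n)
pairsLt n = concatMap (λ i → concatMap (λ j → if toℕ i <ᵇ toℕ j then (i , j) ∷ [] else []) (finList n)) (finList n)

-- The symmetric group S_n : bijective maps (= injective maps of Fin n)
isPerm : ∀ {n} → Perm n → Bool
isPerm {n} v = all (λ p → not ⌊ lookup v (Data.Product.proj₁ p) ≟F lookup v (Data.Product.proj₂ p) ⌋) (pairsLt n)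

inversions : ∀ {n} → Perm n → ℕ
inversions {n} v = L.length (L.filterᵇ (λ p → toℕ (lookup v (Data.Product.proj₂ p)) <ᵇ toℕ (lookup v (Data.Product.proj₁ p))) (pairsLt n))

isEvenℕ : ℕ → Bool
isEvenℕ zero = true
isEvenℕ (suc k) = not (isEvenℕ k)

inAlt : ∀ {n} → Perm n → Bool
inAlt v = isPerm v ∧ isEvenℕ (inversions v)

-- the generating set T(A_n) = { (1 2)(i j) | 1 ≤ i < j ≤ n }  (as a list, for n ≥ 2;
-- for n < 2 the transposition (1 2) does not exist and the list is empty)
gens : (n : ℕ) → List (Perm n)
gens zero = []
gens (suc zero) = []
gens (suc (suc k)) = map (λ p → swap 0F (sucF 0F) ∘ₚ swap (Data.Product.proj₁ p) (Data.Product.proj₂ p)) (pairsLt (suc (suc k)))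

products : (n k : ℕ) → List (Perm n)
products n zero = idₚ ∷ []
products n (suc k) = concatMap (λ t → map (t ∘ₚ_) (products n k)) (gens n)

isProductOf : ∀ {n} → ℕ → Perm n → Bool
isProductOf {n} k v = any (_== v) (products n k)

hasLength : ∀ {n} → Perm n → ℕ → Bool
hasLength v m = isProductOf m v ∧ not (any (λ k → isProductOf k v) (upTo m))

countᵇ : ∀ {A : Set} → (A → Bool) → List A → ℕ
countᵇ p xs = L.length (L.filterᵇ p xs)

a : ℕ → ℕ → ℕ
a n m = countᵇ (λ v → inAlt v ∧ hasLength v m) (allVecs n n)

module Submission where

-- a(n,1) counts the v ∈ A_n of length exactly one, i.e. the elements of
-- T(A_n) other than the identity.  Write g(i,j) = (1 2)(i j) for i < j.
--   * Every g(i,j) is even: its inversion number is computed explicitly.  A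
--     transposition (a b) has an odd number of inversions, and the cases in
--     which (1 2) meets {a,b} are evaluated directly.
--   * g is injective on ordered pairs, and g(1,2) is the only pair giving the
--     identity.
-- So v has length one iff v = g(i,j) for exactly one pair (i,j) ≠ (1,2).
-- Counting the set {(v,(i,j)) | v = g(i,j), (i,j) ≠ (1,2)} over the list of
-- all vectors first by v and then by (i,j) gives a(n,1) = C(n,2) − 1, and the
-- recurrence a(n,1) = a(n−1,1) + (n−1) follows from C(n,2) = C(n−1,2) + (n−1).
-- Points are indexed from 0, so (1 2) is the pair (0 , 1) below.

open import Defs
open import Data.Nat using (ℕ; zero; suc; _+_; _∸_; _≤_; _<_; z≤n; s≤s; _<ᵇ_; _≡ᵇ_)
import Data.Nat.Properties as ℕₚ
open import Data.Nat.Tactic.RingSolver using (solve-∀)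
open import Data.Bool using (Bool; true; false; _∧_; _∨_; not; if_then_else_)
open import Data.Bool.Properties using (T-≡; ∧-zeroʳ)
open import Data.Empty using (⊥-elim)
open import Data.Product using (Σ; _,_; _×_; proj₁; proj₂)
open import Data.Sum using (_⊎_; inj₁; inj₂)
open import Data.Fin using (Fin; toℕ) renaming (zero to 0F; suc to sucF)
open import Data.Fin.Properties using (toℕ-injective; toℕ<n) renaming (_≟_ to _≟F_)
open import Data.Vec using (Vec; []; _∷_; lookup)
open import Data.Vec.Properties using (lookup∘tabulate; tabulate∘lookup; tabulate-cong; ≡-dec)
open import Data.List as L using (List; []; _∷_; map; concatMap; _++_)
open import Data.Bool.ListAction using (any; all)
open import Function.Bundles using (Equivalence)
open import Relation.Nullary using (yes; no; ¬_)
open import Relation.Nullary.Decidable using (⌊_⌋)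
open import Relation.Binary.PropositionalEquality
open ≡-Reasoning

≡ᵇ-sound : ∀ m n → (m ≡ᵇ n) ≡ true → m ≡ n
≡ᵇ-sound m n e = ℕₚ.≡ᵇ⇒≡ m n (Equivalence.from T-≡ e)

≡ᵇ-refl : ∀ n → (n ≡ᵇ n) ≡ true
≡ᵇ-refl n = Equivalence.to T-≡ (ℕₚ.≡⇒≡ᵇ n n refl)

≡ᵇ-false : ∀ m n → m ≢ n → (m ≡ᵇ n) ≡ false
≡ᵇ-false m n m≢n with m ≡ᵇ n in e
... | true = ⊥-elim (m≢n (≡ᵇ-sound m n e))
... | false = refl

≡ᵇ-sym : ∀ m n → (m ≡ᵇ n) ≡ (n ≡ᵇ m)
≡ᵇ-sym zero zero = refl
≡ᵇ-sym zero (suc n) = refl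
≡ᵇ-sym (suc m) zero = refl
≡ᵇ-sym (suc m) (suc n) = ≡ᵇ-sym m n

≟F-toℕ : ∀ {n} (x y : Fin n) → ⌊ x ≟F y ⌋ ≡ (toℕ x ≡ᵇ toℕ y)
≟F-toℕ x y with x ≟F y
... | yes refl = sym (≡ᵇ-refl (toℕ x))
... | no x≢y = sym (≡ᵇ-false _ _ (λ e → x≢y (toℕ-injective e)))

∧-trueˡ : ∀ a b → a ∧ b ≡ true → a ≡ true
∧-trueˡ true b e = refl

∧-trueʳ : ∀ a b → a ∧ b ≡ true → b ≡ true
∧-trueʳ true b e = e

ind : Bool → ℕ
ind true = 1
ind false = 0

countBelow : ℕ → (ℕ → Bool) → ℕ
countBelow zero P = 0
countBelow (suc n) P = ind (P 0) + countBelow n (λ q → P (suc q))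

countPairs : ℕ → (ℕ → ℕ → Bool) → ℕ
countPairs zero Q = 0
countPairs (suc n) Q = countBelow n (λ q → Q 0 (suc q)) + countPairs n (λ x y → Q (suc x) (suc y))

countBelow-cong : ∀ n {P P' : ℕ → Bool} → (∀ q → P q ≡ P' q) → countBelow n P ≡ countBelow n P'
countBelow-cong zero e = refl
countBelow-cong (suc n) e = cong₂ _+_ (cong ind (e 0)) (countBelow-cong n (λ q → e (suc q)))

countPairs-cong : ∀ n {Q Q' : ℕ → ℕ → Bool} → (∀ x y → Q x y ≡ Q' x y) → countPairs n Q ≡ countPairs n Q'
countPairs-cong zero e = refl
countPairs-cong (suc n) e =
  cong₂ _+_ (countBelow-cong n (λ q → e 0 (suc q))) (countPairs-cong n (λ x y → e (suc x) (suc y)))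

countBelow-none : ∀ n {P : ℕ → Bool} → (∀ q → P q ≡ false) → countBelow n P ≡ 0
countBelow-none zero e = refl
countBelow-none (suc n) e rewrite e 0 = countBelow-none n (λ q → e (suc q))

countPairs-none : ∀ n {Q : ℕ → ℕ → Bool} → (∀ x y → Q x y ≡ false) → countPairs n Q ≡ 0
countPairs-none zero e = refl
countPairs-none (suc n) e rewrite countBelow-none n (λ q → e 0 (suc q)) =
  countPairs-none n (λ x y → e (suc x) (suc y))

countBelow-all : ∀ n → countBelow n (λ _ → true) ≡ n
countBelow-all zero = refl
countBelow-all (suc n) = cong suc (countBelow-all n)

countBelow-prefix : ∀ n k {P : ℕ → Bool} → (∀ q → P q ≡ (q <ᵇ k)) → k ≤ n → countBelow n P ≡ k
countBelow-prefix zero .zero e z≤n = refl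
countBelow-prefix (suc n) zero e _ rewrite e 0 = countBelow-none n (λ q → e (suc q))
countBelow-prefix (suc n) (suc k) e (s≤s k≤n) rewrite e 0 = cong suc (countBelow-prefix n k (λ q → e (suc q)) k≤n)

countBelow-single : ∀ n k {P : ℕ → Bool} → (∀ q → P q ≡ (q ≡ᵇ k)) → k < n → countBelow n P ≡ 1
countBelow-single (suc n) zero e _ rewrite e 0 = cong suc (countBelow-none n (λ q → e (suc q)))
countBelow-single (suc n) (suc k) e (s≤s k<n) rewrite e 0 = countBelow-single n k (λ q → e (suc q)) k<n

countPairs-single : ∀ n a b → a < b → b < n → countPairs n (λ x y → (x ≡ᵇ a) ∧ (y ≡ᵇ b)) ≡ 1
countPairs-single (suc m) zero (suc b) _ (s≤s b<m) =
  cong₂ _+_ (countBelow-single m b (λ q → refl) b<m) (countPairs-none m (λ _ _ → refl))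
countPairs-single (suc m) (suc a) (suc b) (s≤s a<b) (s≤s b<m) =
  cong₂ _+_ (countBelow-none m (λ _ → refl)) (countPairs-single m a b a<b b<m)

inversionsℕ : ℕ → (ℕ → ℕ) → ℕ
inversionsℕ n f = countPairs n (λ x y → f y <ᵇ f x)

inversionsℕ-relabel : ∀ n {f h : ℕ → ℕ} (φ : ℕ → ℕ) → (∀ x → h x ≡ φ (f x)) →
                      (∀ a b → (φ a <ᵇ φ b) ≡ (a <ᵇ b)) → inversionsℕ n h ≡ inversionsℕ n f
inversionsℕ-relabel n {f} φ h≡φf φ-mono =
  countPairs-cong n (λ x y → trans (cong₂ _<ᵇ_ (h≡φf y) (h≡φf x)) (φ-mono (f y) (f x)))

inversionsℕ-increasing : ∀ n {f : ℕ → ℕ} → (∀ a b → (f a <ᵇ f b) ≡ (a <ᵇ b)) → inversionsℕ n f ≡ 0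
inversionsℕ-increasing zero mono = refl
inversionsℕ-increasing (suc n) {f} mono =
  cong₂ _+_ (countBelow-none n (λ q → mono (suc q) 0))
            (inversionsℕ-increasing n {λ x → f (suc x)} (λ a b → mono (suc a) (suc b)))

sw : ℕ → ℕ → ℕ → ℕ
sw a b x = if x ≡ᵇ a then b else (if x ≡ᵇ b then a else x)

s01 : ℕ → ℕ
s01 = sw 0 1

gℕ : ℕ → ℕ → ℕ → ℕ
gℕ a b x = s01 (sw a b x)

moveToFront : ℕ → ℕ → ℕ
moveToFront c q = if q ≡ᵇ c then 0 else suc q

skipOne : ℕ → ℕ
skipOne zero = zero
skipOne (suc z) = suc (suc z)

skipOne-mono : ∀ a b → (skipOne a <ᵇ skipOne b) ≡ (a <ᵇ b)
skipOne-mono zero zero = refl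
skipOne-mono zero (suc b) = refl
skipOne-mono (suc a) zero = refl
skipOne-mono (suc a) (suc b) = refl

<ᵇ-suc-self : ∀ q → (q <ᵇ suc q) ≡ true
<ᵇ-suc-self zero = refl
<ᵇ-suc-self (suc q) = <ᵇ-suc-self q

<ᵇ-suc-≢ : ∀ q c → (q ≡ᵇ c) ≡ false → (q <ᵇ suc c) ≡ (q <ᵇ c)
<ᵇ-suc-≢ zero (suc c) e = refl
<ᵇ-suc-≢ (suc q) zero e = refl
<ᵇ-suc-≢ (suc q) (suc c) e = <ᵇ-suc-≢ q c e

moveToFront-<ᵇ : ∀ q d → (moveToFront d q <ᵇ suc d) ≡ (q <ᵇ suc d)
moveToFront-<ᵇ q d with q ≡ᵇ d in e
... | true rewrite ≡ᵇ-sound q d e = sym (<ᵇ-suc-self d)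
... | false = sym (<ᵇ-suc-≢ q d e)

-- The only inversions of moveToFront c are the pairs (q , c) with q < c.
inversionsℕ-moveToFront : ∀ m c → c < m → inversionsℕ m (moveToFront c) ≡ c
inversionsℕ-moveToFront (suc m) zero _ =
  cong₂ _+_ (countBelow-none m (λ q → refl)) (inversionsℕ-increasing m {λ q → suc (suc q)} (λ a b → refl))
inversionsℕ-moveToFront (suc m) (suc c) (s≤s c<m) =
  cong₂ _+_ (countBelow-single m c only-c c<m)
            (trans (inversionsℕ-relabel m skipOne tail skipOne-mono) (inversionsℕ-moveToFront m c c<m))
  where
  only-c : ∀ q → (moveToFront (suc c) (suc q) <ᵇ 1) ≡ (q ≡ᵇ c)
  only-c q with q ≡ᵇ c
  ... | true = refl
  ... | false = refl
  tail : ∀ x → moveToFront (suc c) (suc x) ≡ skipOne (moveToFront c x)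
  tail x with x ≡ᵇ c
  ... | true = refl
  ... | false = refl

sw-suc : ∀ a b q → sw (suc a) (suc b) (suc q) ≡ suc (sw a b q)
sw-suc a b q with q ≡ᵇ a
... | true = refl
... | false with q ≡ᵇ b
... | true = refl
... | false = refl

Odd : ℕ → Set
Odd x = Σ ℕ (λ d → x ≡ suc (d + d))

-- A transposition (a b) with a < b has 2(b − a) − 1 inversions, in particular
-- an odd number: for a = 0 they are the b pairs (0 , q), q ≤ b, and the b − 1
-- inversions of the remaining points, which form moveToFront.
transposition-odd : ∀ a b m → a < b → b < m → Odd (inversionsℕ m (sw a b))
transposition-odd zero (suc d) (suc m) _ (s≤s d<m) =
  d , cong₂ _+_ (countBelow-prefix m (suc d) (λ q → moveToFront-<ᵇ q d) d<m) (inversionsℕ-moveToFront m d d<m)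
transposition-odd (suc a) (suc b) (suc m) (s≤s a<b) (s≤s b<m) with transposition-odd a b m a<b b<m
... | d , odd = d , trans (cong₂ _+_ (countBelow-none m (λ q → refl))
                                       (inversionsℕ-relabel m suc (sw-suc a b) (λ x y → refl))) odd

isEven-double+2 : ∀ d → isEvenℕ (suc (suc (d + d))) ≡ true
isEven-double+2 zero = refl
isEven-double+2 (suc d) rewrite ℕₚ.+-suc d d | isEven-double+2 d = refl

-- Every (1 2)(a b) with a < b, (a , b) ≠ (0 , 1), has an even number of
-- inversions; the three cases are according to how {0,1} meets {a,b}.
gℕ-0b-even : ∀ c m → c < m → isEvenℕ (inversionsℕ (suc (suc m)) (gℕ 0 (suc (suc c)))) ≡ true
gℕ-0b-even c m c<m =
  trans (cong isEvenℕ (cong₂ _+_ (countBelow-prefix (suc m) (suc (suc c)) first (s≤s c<m))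
          (cong₂ _+_ (countBelow-none m (λ q → refl))
                     (trans (inversionsℕ-relabel m suc tail (λ x y → refl)) (inversionsℕ-moveToFront m c c<m)))))
        (isEven-double+2 c)
  where
  tail : ∀ q → gℕ 0 (suc (suc c)) (suc (suc q)) ≡ suc (moveToFront c q)
  tail q with q ≡ᵇ c
  ... | true = refl
  ... | false = refl
  first : ∀ q → (gℕ 0 (suc (suc c)) (suc q) <ᵇ suc (suc c)) ≡ (q <ᵇ suc (suc c))
  first zero = refl
  first (suc q) rewrite tail q = moveToFront-<ᵇ q c

gℕ-1b-even : ∀ c m → c < m → isEvenℕ (inversionsℕ (suc (suc m)) (gℕ 1 (suc (suc c)))) ≡ true
gℕ-1b-even c m c<m =
  trans (cong isEvenℕ (cong₂ _+_ (countBelow-single (suc m) (suc c) first (s≤s c<m))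
          (cong₂ _+_ (countBelow-prefix m (suc c) second c<m)
                     (trans (inversionsℕ-relabel m skipOne tail skipOne-mono) (inversionsℕ-moveToFront m c c<m)))))
        (isEven-double+2 c)
  where
  tail : ∀ q → gℕ 1 (suc (suc c)) (suc (suc q)) ≡ skipOne (moveToFront c q)
  tail q with q ≡ᵇ c
  ... | true = refl
  ... | false = refl
  first : ∀ q → (gℕ 1 (suc (suc c)) (suc q) <ᵇ 1) ≡ (q ≡ᵇ suc c)
  first zero = refl
  first (suc q) rewrite tail q with q ≡ᵇ c
  ... | true = refl
  ... | false = refl
  second : ∀ q → (gℕ 1 (suc (suc c)) (suc (suc q)) <ᵇ suc (suc c)) ≡ (q <ᵇ suc c)
  second q rewrite tail q = trans (skipOne-mono (moveToFront c q) (suc c)) (moveToFront-<ᵇ q c)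

gℕ-ab-even : ∀ a b m → a < b → b < m → isEvenℕ (inversionsℕ (suc (suc m)) (gℕ (suc (suc a)) (suc (suc b)))) ≡ true
gℕ-ab-even a b m a<b b<m with transposition-odd a b m a<b b<m
... | d , odd =
  trans (cong isEvenℕ (cong₂ _+_ (countBelow-single (suc m) 0 first (s≤s z≤n))
          (cong₂ _+_ (countBelow-none m (λ q → refl))
                     (trans (inversionsℕ-relabel m (λ z → suc (suc z)) tail (λ x y → refl)) odd))))
        (isEven-double+2 d)
  where
  tail : ∀ q → gℕ (suc (suc a)) (suc (suc b)) (suc (suc q)) ≡ suc (suc (sw a b q))
  tail q rewrite sw-suc (suc a) (suc b) (suc q) | sw-suc a b q = refl
  first : ∀ q → (gℕ (suc (suc a)) (suc (suc b)) (suc q) <ᵇ 1) ≡ (q ≡ᵇ 0)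
  first zero = refl
  first (suc q) rewrite tail q = refl

gℕ-even : ∀ a b n → a < b → b < n → ¬ (a ≡ 0 × b ≡ 1) → isEvenℕ (inversionsℕ n (gℕ a b)) ≡ true
gℕ-even zero (suc zero) n _ _ ≢01 = ⊥-elim (≢01 (refl , refl))
gℕ-even (suc zero) (suc zero) n (s≤s ()) _ _
gℕ-even zero (suc (suc c)) (suc (suc m)) _ (s≤s (s≤s c<m)) _ = gℕ-0b-even c m c<m
gℕ-even (suc zero) (suc (suc c)) (suc (suc m)) _ (s≤s (s≤s c<m)) _ = gℕ-1b-even c m c<m
gℕ-even (suc (suc a)) (suc (suc b)) (suc (suc m)) (s≤s (s≤s a<b)) (s≤s (s≤s b<m)) _ = gℕ-ab-even a b m a<b b<m

sumL : ∀ {A : Set} → List A → (A → ℕ) → ℕ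
sumL [] F = 0
sumL (x ∷ xs) F = F x + sumL xs F

sumFin : (n : ℕ) → (Fin n → ℕ) → ℕ
sumFin zero F = 0
sumFin (suc n) F = F 0F + sumFin n (λ x → F (sucF x))

countᵇ-sumL : ∀ {A : Set} (Q : A → Bool) xs → countᵇ Q xs ≡ sumL xs (λ x → ind (Q x))
countᵇ-sumL Q [] = refl
countᵇ-sumL Q (x ∷ xs) with Q x
... | true = cong suc (countᵇ-sumL Q xs)
... | false = countᵇ-sumL Q xs

sumL-cong : ∀ {A : Set} (xs : List A) {F F' : A → ℕ} → (∀ x → F x ≡ F' x) → sumL xs F ≡ sumL xs F'
sumL-cong [] e = refl
sumL-cong (x ∷ xs) e = cong₂ _+_ (e x) (sumL-cong xs e)

sumFin-cong : ∀ n {F F' : Fin n → ℕ} → (∀ x → F x ≡ F' x) → sumFin n F ≡ sumFin n F'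
sumFin-cong zero e = refl
sumFin-cong (suc n) e = cong₂ _+_ (e 0F) (sumFin-cong n (λ x → e (sucF x)))

sumL-zero : ∀ {A : Set} (xs : List A) {F : A → ℕ} → (∀ x → F x ≡ 0) → sumL xs F ≡ 0
sumL-zero [] e = refl
sumL-zero (x ∷ xs) e rewrite e x = sumL-zero xs e

sumL-++ : ∀ {A : Set} (xs ys : List A) F → sumL (xs ++ ys) F ≡ sumL xs F + sumL ys F
sumL-++ [] ys F = refl
sumL-++ (x ∷ xs) ys F = trans (cong (F x +_) (sumL-++ xs ys F)) (sym (ℕₚ.+-assoc (F x) _ _))

sumL-concatMap : ∀ {A B : Set} (h : A → List B) (xs : List A) F →
                 sumL (concatMap h xs) F ≡ sumL xs (λ x → sumL (h x) F)
sumL-concatMap h [] F = refl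
sumL-concatMap h (x ∷ xs) F =
  trans (sumL-++ (h x) (concatMap h xs) F) (cong (sumL (h x) F +_) (sumL-concatMap h xs F))

sumL-map : ∀ {A B : Set} (f : A → B) (xs : List A) F → sumL (map f xs) F ≡ sumL xs (λ x → F (f x))
sumL-map f [] F = refl
sumL-map f (x ∷ xs) F = cong (F (f x) +_) (sumL-map f xs F)

sumL-tabulate : ∀ {A : Set} n (G : Fin n → A) F → sumL (L.tabulate G) F ≡ sumFin n (λ x → F (G x))
sumL-tabulate zero G F = refl
sumL-tabulate (suc n) G F = cong (F (G 0F) +_) (sumL-tabulate n (λ x → G (sucF x)) F)

sumL-swap : ∀ {A B : Set} (xs : List A) (ys : List B) (H : A → B → ℕ) →
            sumL xs (λ x → sumL ys (λ y → H x y)) ≡ sumL ys (λ y → sumL xs (λ x → H x y))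
sumL-swap [] ys H = sym (sumL-zero ys (λ y → refl))
sumL-swap (x ∷ xs) ys H = trans (cong (sumL ys (H x) +_) (sumL-swap xs ys H)) (sym (sumL-+ ys))
  where
  interchange : ∀ a b c d → (a + b) + (c + d) ≡ (a + c) + (b + d)
  interchange = solve-∀
  sumL-+ : ∀ (zs : List _) → sumL zs (λ y → H x y + sumL xs (λ x' → H x' y)) ≡
                             sumL zs (H x) + sumL zs (λ y → sumL xs (λ x' → H x' y))
  sumL-+ [] = refl
  sumL-+ (z ∷ zs) rewrite sumL-+ zs = interchange (H x z) _ _ _

countPairsFin : (n : ℕ) → (Fin n → Fin n → Bool) → ℕ
countPairsFin zero Q = 0
countPairsFin (suc n) Q = sumFin n (λ j → ind (Q 0F (sucF j))) + countPairsFin n (λ a b → Q (sucF a) (sucF b))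

pairTerm : ∀ {n} (Q : Fin n → Fin n → Bool) (i j : Fin n) → ℕ
pairTerm Q i j = sumL (if toℕ i <ᵇ toℕ j then (i , j) ∷ [] else []) (λ p → ind (Q (proj₁ p) (proj₂ p)))

pairTerm-suc : ∀ {n} (Q : Fin (suc n) → Fin (suc n) → Bool) i j →
               pairTerm Q (sucF i) (sucF j) ≡ pairTerm (λ a b → Q (sucF a) (sucF b)) i j
pairTerm-suc Q i j with toℕ i <ᵇ toℕ j
... | true = refl
... | false = refl

sumFin-pairTerm : ∀ n Q → sumFin n (λ i → sumFin n (λ j → pairTerm Q i j)) ≡ countPairsFin n Q
sumFin-pairTerm zero Q = refl
sumFin-pairTerm (suc n) Q =
  cong₂ _+_ (sumFin-cong n (λ j → ℕₚ.+-identityʳ _))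
            (trans (sumFin-cong n (λ i → sumFin-cong n (λ j → pairTerm-suc Q i j)))
                   (sumFin-pairTerm n (λ a b → Q (sucF a) (sucF b))))

sumL-pairsLt : ∀ n (Q : Fin n → Fin n → Bool) →
               sumL (pairsLt n) (λ p → ind (Q (proj₁ p) (proj₂ p))) ≡ countPairsFin n Q
sumL-pairsLt n Q =
  trans (sumL-concatMap _ (finList n) _)
  (trans (sumL-tabulate n (λ x → x) _)
  (trans (sumFin-cong n (λ i → trans (sumL-concatMap _ (finList n) _) (sumL-tabulate n (λ x → x) _)))
         (sumFin-pairTerm n Q)))

countᵇ-pairsLt : ∀ n (Q : Fin n × Fin n → Bool) → countᵇ Q (pairsLt n) ≡ countPairsFin n (λ a b → Q (a , b))
countᵇ-pairsLt n Q = trans (countᵇ-sumL Q (pairsLt n)) (sumL-pairsLt n (λ a b → Q (a , b)))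

sumFin-countBelow : ∀ n (P : Fin n → Bool) Pℕ → (∀ j → P j ≡ Pℕ (toℕ j)) →
                    sumFin n (λ j → ind (P j)) ≡ countBelow n Pℕ
sumFin-countBelow zero P Pℕ e = refl
sumFin-countBelow (suc n) P Pℕ e =
  cong₂ _+_ (cong ind (e 0F)) (sumFin-countBelow n (λ j → P (sucF j)) (λ q → Pℕ (suc q)) (λ j → e (sucF j)))

countPairsFin-toℕ : ∀ n Q Qℕ → (∀ a b → Q a b ≡ Qℕ (toℕ a) (toℕ b)) → countPairsFin n Q ≡ countPairs n Qℕ
countPairsFin-toℕ zero Q Qℕ e = refl
countPairsFin-toℕ (suc n) Q Qℕ e =
  cong₂ _+_ (sumFin-countBelow n _ _ (λ j → e 0F (sucF j)))
            (countPairsFin-toℕ n _ (λ a b → Qℕ (suc a) (suc b)) (λ a b → e (sucF a) (sucF b)))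

countPairsFin-cong< : ∀ n {Q Q' : Fin n → Fin n → Bool} → (∀ a b → toℕ a < toℕ b → Q a b ≡ Q' a b) →
                      countPairsFin n Q ≡ countPairsFin n Q'
countPairsFin-cong< zero e = refl
countPairsFin-cong< (suc n) e =
  cong₂ _+_ (sumFin-cong n (λ j → cong ind (e 0F (sucF j) (s≤s z≤n))))
            (countPairsFin-cong< n (λ a b a<b → e (sucF a) (sucF b) (s≤s a<b)))

countPairsFin-none : ∀ n Q → (∀ a b → toℕ a < toℕ b → Q a b ≡ false) → countPairsFin n Q ≡ 0
countPairsFin-none n Q none =
  trans (countPairsFin-cong< n none)
        (trans (countPairsFin-toℕ n _ (λ _ _ → false) (λ _ _ → refl)) (countPairs-none n (λ _ _ → refl)))

sumFin-pos : ∀ n (F : Fin n → ℕ) j → 0 < F j → 0 < sumFin n F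
sumFin-pos (suc n) F 0F p = ℕₚ.≤-trans p (ℕₚ.m≤m+n _ _)
sumFin-pos (suc n) F (sucF j) p = ℕₚ.≤-trans (sumFin-pos n (λ x → F (sucF x)) j p) (ℕₚ.m≤n+m _ _)

countPairsFin-pos : ∀ n Q (a b : Fin n) → toℕ a < toℕ b → Q a b ≡ true → 0 < countPairsFin n Q
countPairsFin-pos (suc n) Q 0F (sucF j) _ e =
  ℕₚ.≤-trans (sumFin-pos n (λ j → ind (Q 0F (sucF j))) j (subst (λ z → 0 < ind z) (sym e) (s≤s z≤n)))
             (ℕₚ.m≤m+n _ _)
countPairsFin-pos (suc n) Q (sucF a) (sucF b) (s≤s a<b) e =
  ℕₚ.≤-trans (countPairsFin-pos n (λ a b → Q (sucF a) (sucF b)) a b a<b e) (ℕₚ.m≤n+m _ _)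

+-pos : ∀ x y → 0 < x + y → 0 < x ⊎ 0 < y
+-pos zero y p = inj₂ p
+-pos (suc x) y p = inj₁ (s≤s z≤n)

ind-pos : ∀ b → 0 < ind b → b ≡ true
ind-pos true p = refl

sumFin-witness : ∀ n (P : Fin n → Bool) → 0 < sumFin n (λ j → ind (P j)) → Σ (Fin n) (λ j → P j ≡ true)
sumFin-witness (suc n) P p with +-pos (ind (P 0F)) _ p
... | inj₁ q = 0F , ind-pos _ q
... | inj₂ q with sumFin-witness n (λ j → P (sucF j)) q
... | j , e = sucF j , e

countPairsFin-witness : ∀ n Q → 0 < countPairsFin n Q →
                        Σ (Fin n) λ a → Σ (Fin n) λ b → toℕ a < toℕ b × Q a b ≡ true
countPairsFin-witness (suc n) Q p with +-pos (sumFin n (λ j → ind (Q 0F (sucF j)))) _ p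
... | inj₁ q with sumFin-witness n (λ j → Q 0F (sucF j)) q
... | j , e = 0F , sucF j , s≤s z≤n , e
countPairsFin-witness (suc n) Q p | inj₂ q with countPairsFin-witness n (λ a b → Q (sucF a) (sucF b)) q
... | a , b , a<b , e = sucF a , sucF b , s≤s a<b , e

all-countᵇ : ∀ {A : Set} (f : A → Bool) xs → countᵇ (λ x → not (f x)) xs ≡ 0 → all f xs ≡ true
all-countᵇ f [] e = refl
all-countᵇ f (x ∷ xs) e with f x
... | true = all-countᵇ f xs e

countᵇ-any : ∀ {A : Set} (f : A → Bool) xs → 0 < countᵇ f xs → any f xs ≡ true
countᵇ-any f (x ∷ xs) p with f x
... | true = refl
... | false = countᵇ-any f xs p

any-countᵇ : ∀ {A : Set} (f f' : A → Bool) xs → any f xs ≡ true → (∀ x → f x ≡ true → f' x ≡ true) →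
             0 < countᵇ f' xs
any-countᵇ f f' (x ∷ xs) e f⇒f' with f x in e1
... | true rewrite f⇒f' x e1 = s≤s z≤n
... | false with f' x
...   | true = s≤s z≤n
...   | false = any-countᵇ f f' xs e f⇒f'

lookup-∘ₚ : ∀ {n} (σ τ : Perm n) x → lookup (σ ∘ₚ τ) x ≡ lookup σ (lookup τ x)
lookup-∘ₚ σ τ x = lookup∘tabulate (λ x → lookup σ (lookup τ x)) x

toℕ-swap : ∀ {n} (i j x : Fin n) → toℕ (lookup (swap i j) x) ≡ sw (toℕ i) (toℕ j) (toℕ x)
toℕ-swap i j x
  rewrite lookup∘tabulate (λ x → if ⌊ x ≟F i ⌋ then j else (if ⌊ x ≟F j ⌋ then i else x)) x
        | ≟F-toℕ x i | ≟F-toℕ x j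
  with toℕ x ≡ᵇ toℕ i | toℕ x ≡ᵇ toℕ j
... | true | _ = refl
... | false | true = refl
... | false | false = refl

vec-ext : ∀ {n} {A : Set} (u w : Vec A n) → (∀ x → lookup u x ≡ lookup w x) → u ≡ w
vec-ext u w e = trans (sym (tabulate∘lookup u)) (trans (tabulate-cong e) (tabulate∘lookup w))

==-sound : ∀ {n} (u w : Perm n) → (u == w) ≡ true → u ≡ w
==-sound u w e with ≡-dec _≟F_ u w
... | yes u≡w = u≡w

==-refl : ∀ {n} (u : Perm n) → (u == u) ≡ true
==-refl u with ≡-dec _≟F_ u u
... | yes _ = refl
... | no u≢u = ⊥-elim (u≢u refl)

==-false : ∀ {n} (u w : Perm n) → u ≢ w → (u == w) ≡ false
==-false u w u≢w with ≡-dec _≟F_ u w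
... | yes u≡w = ⊥-elim (u≢w u≡w)
... | no _ = refl

sw-involutive : ∀ a b x → sw a b (sw a b x) ≡ x
sw-involutive a b x with x ≡ᵇ a in e1
... | true with b ≡ᵇ a in e2
...   | true = trans (≡ᵇ-sound b a e2) (sym (≡ᵇ-sound x a e1))
...   | false rewrite ≡ᵇ-refl b = sym (≡ᵇ-sound x a e1)
sw-involutive a b x | false with x ≡ᵇ b in e2
...   | true rewrite ≡ᵇ-refl a = sym (≡ᵇ-sound x b e2)
...   | false rewrite e1 | e2 = refl

s01-involutive : ∀ x → s01 (s01 x) ≡ x
s01-involutive zero = refl
s01-involutive (suc zero) = refl
s01-involutive (suc (suc x)) = refl

s01-injective : ∀ x y → s01 x ≡ s01 y → x ≡ y
s01-injective x y e = trans (sym (s01-involutive x)) (trans (cong s01 e) (s01-involutive y))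

gℕ-injective : ∀ a b x y → gℕ a b x ≡ gℕ a b y → x ≡ y
gℕ-injective a b x y e =
  trans (sym (sw-involutive a b x))
        (trans (cong (sw a b) (s01-injective (sw a b x) (sw a b y) e)) (sw-involutive a b y))

gℕ-self : ∀ a b → gℕ a b a ≡ s01 b
gℕ-self a b rewrite ≡ᵇ-refl a = refl

sw-pair : ∀ a b c d → a < b → c < d → b ≡ sw c d a → a ≡ c × b ≡ d
sw-pair a b c d a<b c<d e with a ≡ᵇ c in e1
... | true = ≡ᵇ-sound a c e1 , e
... | false with a ≡ᵇ d in e2
...   | true = ⊥-elim (ℕₚ.<-irrefl (sym e) (ℕₚ.<-trans c<d (subst (_< b) (≡ᵇ-sound a d e2) a<b)))
...   | false = ⊥-elim (ℕₚ.<-irrefl (sym e) a<b)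

gℕ-fixes : ∀ a b → a < b → b ≡ s01 a → a ≡ 0 × b ≡ 1
gℕ-fixes zero b _ e = refl , e
gℕ-fixes (suc zero) .0 () refl
gℕ-fixes (suc (suc a)) b a<b e = ⊥-elim (ℕₚ.<-irrefl (sym e) a<b)

module Generators (k : ℕ) where

  N : ℕ
  N = suc (suc k)

  gen : Fin N × Fin N → Perm N
  gen p = swap 0F (sucF 0F) ∘ₚ swap (proj₁ p) (proj₂ p)

  toℕ-gen : ∀ (i j x : Fin N) → toℕ (lookup (gen (i , j)) x) ≡ gℕ (toℕ i) (toℕ j) (toℕ x)
  toℕ-gen i j x = trans (cong toℕ (lookup-∘ₚ (swap 0F (sucF 0F)) (swap i j) x))
    (trans (toℕ-swap 0F (sucF 0F) (lookup (swap i j) x)) (cong s01 (toℕ-swap i j x)))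

  gen-∘id : ∀ p → gen p ∘ₚ idₚ ≡ gen p
  gen-∘id p = vec-ext _ _ (λ x →
    trans (lookup-∘ₚ (gen p) idₚ x) (cong (lookup (gen p)) (lookup∘tabulate (λ x → x) x)))

  gen-at-first : ∀ (i j : Fin N) → s01 (toℕ (lookup (gen (i , j)) i)) ≡ toℕ j
  gen-at-first i j = trans (cong s01 (trans (toℕ-gen i j i) (gℕ-self (toℕ i) (toℕ j)))) (s01-involutive (toℕ j))

  gen-injective : ∀ (i j i' j' : Fin N) → toℕ i < toℕ j → toℕ i' < toℕ j' →
                  gen (i , j) ≡ gen (i' , j') → (i , j) ≡ (i' , j')
  gen-injective i j i' j' i<j i'<j' e with sw-pair (toℕ i) (toℕ j) (toℕ i') (toℕ j') i<j i'<j' same-image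
    where
    same-image : toℕ j ≡ sw (toℕ i') (toℕ j') (toℕ i)
    same-image = trans (sym (gen-at-first i j))
      (trans (cong (λ v → s01 (toℕ (lookup v i))) e) (trans (cong s01 (toℕ-gen i' j' i)) (s01-involutive _)))
  ... | i≡i' , j≡j' = cong₂ _,_ (toℕ-injective i≡i') (toℕ-injective j≡j')

  gen-identity : ∀ (i j : Fin N) → toℕ i < toℕ j → gen (i , j) ≡ idₚ → toℕ i ≡ 0 × toℕ j ≡ 1
  gen-identity i j i<j e = gℕ-fixes (toℕ i) (toℕ j) i<j
    (trans (sym (gen-at-first i j))
           (cong s01 (trans (cong (λ v → toℕ (lookup v i)) e) (cong toℕ (lookup∘tabulate (λ x → x) i)))))

  gen01 : gen (0F , sucF 0F) ≡ idₚ
  gen01 = vec-ext _ _ (λ x → toℕ-injective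
    (trans (toℕ-gen 0F (sucF 0F) x)
           (trans (s01-involutive (toℕ x)) (sym (cong toℕ (lookup∘tabulate (λ x → x) x))))))

  -- pairs other than (0 , 1), whose generator is (1 2)(1 2) = id
  nontrivial : Fin N × Fin N → Bool
  nontrivial p = not (⌊ proj₁ p ≟F 0F ⌋ ∧ ⌊ proj₂ p ≟F sucF 0F ⌋)

  nontrivial-toℕ : ∀ (i j : Fin N) → nontrivial (i , j) ≡ not ((toℕ i ≡ᵇ 0) ∧ (toℕ j ≡ᵇ 1))
  nontrivial-toℕ i j rewrite ≟F-toℕ i 0F | ≟F-toℕ j (sucF 0F) = refl

  nontrivial-false : ∀ p → nontrivial p ≡ false → p ≡ (0F , sucF 0F)
  nontrivial-false (i , j) e with ⌊ i ≟F 0F ⌋ in e1 | ⌊ j ≟F sucF 0F ⌋ in e2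
  ... | true | true = cong₂ _,_ (toℕ-injective (≡ᵇ-sound _ _ (trans (sym (≟F-toℕ i 0F)) e1)))
                                (toℕ-injective (≡ᵇ-sound _ _ (trans (sym (≟F-toℕ j (sucF 0F))) e2)))

  nontrivial-≢01 : ∀ (i j : Fin N) → nontrivial (i , j) ≡ true → ¬ (toℕ i ≡ 0 × toℕ j ≡ 1)
  nontrivial-≢01 i j e (i≡0 , j≡1) with trans (sym (nontrivial-toℕ i j)) e
  ... | ntr rewrite i≡0 | j≡1 with ntr
  ... | ()

  incidence : Fin N × Fin N → Perm N → Bool
  incidence p v = nontrivial p ∧ (gen p == v)

  isPerm-gen : ∀ (i j : Fin N) → isPerm (gen (i , j)) ≡ true
  isPerm-gen i j = all-countᵇ distinctAt (pairsLt N)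
    (trans (countᵇ-pairsLt N (λ p → not (distinctAt p)))
           (countPairsFin-none N (λ a b → not (distinctAt (a , b))) distinct))
    where
    distinctAt : Fin N × Fin N → Bool
    distinctAt p = not ⌊ lookup (gen (i , j)) (proj₁ p) ≟F lookup (gen (i , j)) (proj₂ p) ⌋
    distinct : ∀ a b → toℕ a < toℕ b → not (distinctAt (a , b)) ≡ false
    distinct a b a<b rewrite ≟F-toℕ (lookup (gen (i , j)) a) (lookup (gen (i , j)) b) | toℕ-gen i j a | toℕ-gen i j b
      | ≡ᵇ-false (gℕ (toℕ i) (toℕ j) (toℕ a)) (gℕ (toℕ i) (toℕ j) (toℕ b))
                 (λ e → ℕₚ.<-irrefl (gℕ-injective _ _ _ _ e) a<b) = refl

  inversions-gen : ∀ (i j : Fin N) → inversions (gen (i , j)) ≡ inversionsℕ N (gℕ (toℕ i) (toℕ j))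
  inversions-gen i j = trans (countᵇ-pairsLt N (λ p → descent (proj₁ p) (proj₂ p)))
    (countPairsFin-toℕ N descent (λ x y → gℕ (toℕ i) (toℕ j) y <ᵇ gℕ (toℕ i) (toℕ j) x)
      (λ a b → cong₂ _<ᵇ_ (toℕ-gen i j b) (toℕ-gen i j a)))
    where
    descent : Fin N → Fin N → Bool
    descent a b = toℕ (lookup (gen (i , j)) b) <ᵇ toℕ (lookup (gen (i , j)) a)

  isProductOf-one : ∀ (v : Perm N) → isProductOf 1 v ≡ any (λ p → (gen p ∘ₚ idₚ) == v) (pairsLt N)
  isProductOf-one v = any-map (pairsLt N)
    where
    any-map : ∀ (xs : List (Fin N × Fin N)) →
              any (_== v) (concatMap (λ t → map (t ∘ₚ_) (idₚ ∷ [])) (map gen xs)) ≡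
              any (λ p → (gen p ∘ₚ idₚ) == v) xs
    any-map [] = refl
    any-map (x ∷ xs) = cong (((gen x ∘ₚ idₚ) == v) ∨_) (any-map xs)

  lengthOne : Perm N → Bool
  lengthOne v = inAlt v ∧ hasLength v 1

  not-identity : ∀ (v : Perm N) → hasLength v 1 ≡ true → (idₚ == v) ≡ false
  not-identity v e = lemma (idₚ == v) (∧-trueʳ (isProductOf 1 v) _ e)
    where
    lemma : ∀ b → not ((b ∨ false) ∨ false) ≡ true → b ≡ false
    lemma false _ = refl

  gen-lengthOne : ∀ (i j : Fin N) → toℕ i < toℕ j → nontrivial (i , j) ≡ true → lengthOne (gen (i , j)) ≡ true
  gen-lengthOne i j i<j ntr = cong₂ _∧_ (cong₂ _∧_ (isPerm-gen i j) even) (cong₂ _∧_ product notZero)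
    where
    v = gen (i , j)
    even : isEvenℕ (inversions v) ≡ true
    even = trans (cong isEvenℕ (inversions-gen i j)) (gℕ-even (toℕ i) (toℕ j) N i<j (toℕ<n j) (nontrivial-≢01 i j ntr))
    product : isProductOf 1 v ≡ true
    product = trans (isProductOf-one v) (countᵇ-any _ (pairsLt N)
      (subst (0 <_) (sym (countᵇ-pairsLt N (λ p → (gen p ∘ₚ idₚ) == v)))
        (countPairsFin-pos N (λ a b → (gen (a , b) ∘ₚ idₚ) == v) i j i<j
          (trans (cong (_== v) (gen-∘id (i , j))) (==-refl v)))))
    notId : (idₚ == v) ≡ false
    notId = ==-false idₚ v (λ e → nontrivial-≢01 i j ntr (gen-identity i j i<j (sym e)))
    notZero : not (any (λ m → isProductOf m v) (L.upTo 1)) ≡ true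
    notZero = cong not (cong (λ z → (z ∨ false) ∨ false) notId)

  lengthOne-gen : ∀ (v : Perm N) → lengthOne v ≡ true →
                  Σ (Fin N) λ a → Σ (Fin N) λ b → toℕ a < toℕ b × incidence (a , b) v ≡ true
  lengthOne-gen v e = countPairsFin-witness N (λ a b → incidence (a , b) v)
    (subst (0 <_) (countᵇ-pairsLt N (λ p → incidence p v))
           (any-countᵇ (λ p → (gen p ∘ₚ idₚ) == v) (λ p → incidence p v) (pairsLt N) isProduct useful))
    where
    hasLength1 : hasLength v 1 ≡ true
    hasLength1 = ∧-trueʳ (inAlt v) _ e
    isProduct : any (λ p → (gen p ∘ₚ idₚ) == v) (pairsLt N) ≡ true
    isProduct = trans (sym (isProductOf-one v)) (∧-trueˡ (isProductOf 1 v) _ hasLength1)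
    trivial-is-id : ∀ p → ((gen p ∘ₚ idₚ) == v) ≡ true → nontrivial p ≡ false → v ≡ idₚ
    trivial-is-id p e' ntr = begin
      v                  ≡⟨ ==-sound (gen p ∘ₚ idₚ) v e' ⟨
      gen p ∘ₚ idₚ       ≡⟨ gen-∘id p ⟩
      gen p              ≡⟨ cong gen (nontrivial-false p ntr) ⟩
      gen (0F , sucF 0F) ≡⟨ gen01 ⟩
      idₚ                ∎
    useful : ∀ p → ((gen p ∘ₚ idₚ) == v) ≡ true → incidence p v ≡ true
    useful p e' with nontrivial p in ntr
    ... | true = subst (λ w → (w == v) ≡ true) (gen-∘id p) e'
    ... | false with () ← trans (sym (==-refl idₚ)) (subst (λ w → (idₚ == w) ≡ false) (trivial-is-id p e' ntr)
                                                           (not-identity v hasLength1))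

  preimages : Perm N → ℕ
  preimages v = countPairsFin N (λ a b → incidence (a , b) v)

  -- a nontrivial generator is hit by exactly one pair, by injectivity of gen
  preimages-gen : ∀ (a₀ b₀ : Fin N) → toℕ a₀ < toℕ b₀ → nontrivial (a₀ , b₀) ≡ true → preimages (gen (a₀ , b₀)) ≡ 1
  preimages-gen a₀ b₀ a₀<b₀ ntr₀ = begin
    preimages (gen (a₀ , b₀))
      ≡⟨ countPairsFin-cong< N same ⟩
    countPairsFin N (λ a b → ⌊ a ≟F a₀ ⌋ ∧ ⌊ b ≟F b₀ ⌋)
      ≡⟨ countPairsFin-toℕ N _ (λ x y → (x ≡ᵇ toℕ a₀) ∧ (y ≡ᵇ toℕ b₀)) by-index ⟩
    countPairs N (λ x y → (x ≡ᵇ toℕ a₀) ∧ (y ≡ᵇ toℕ b₀))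
      ≡⟨ countPairs-single N _ _ a₀<b₀ (toℕ<n b₀) ⟩
    1 ∎
    where
    by-index : ∀ a b → (⌊ a ≟F a₀ ⌋ ∧ ⌊ b ≟F b₀ ⌋) ≡ ((toℕ a ≡ᵇ toℕ a₀) ∧ (toℕ b ≡ᵇ toℕ b₀))
    by-index a b = cong₂ _∧_ (≟F-toℕ a a₀) (≟F-toℕ b b₀)
    differ : ∀ a b → toℕ a < toℕ b → (a , b) ≢ (a₀ , b₀) → incidence (a , b) (gen (a₀ , b₀)) ≡ false
    differ a b a<b ne =
      trans (cong (nontrivial (a , b) ∧_) (==-false _ _ (λ e → ne (gen-injective a b a₀ b₀ a<b a₀<b₀ e)))) (∧-zeroʳ _)
    same : ∀ a b → toℕ a < toℕ b → incidence (a , b) (gen (a₀ , b₀)) ≡ (⌊ a ≟F a₀ ⌋ ∧ ⌊ b ≟F b₀ ⌋)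
    same a b a<b with a ≟F a₀ | b ≟F b₀
    ... | yes refl | yes refl = trans (cong (_∧ (gen (a₀ , b₀) == gen (a₀ , b₀))) ntr₀)
                                      (==-refl (gen (a₀ , b₀)))
    ... | yes refl | no b≢b₀ = differ a b a<b (λ e → b≢b₀ (cong proj₂ e))
    ... | no a≢a₀ | _ = differ a b a<b (λ e → a≢a₀ (cong proj₁ e))

  lengthOne-preimages : ∀ (v : Perm N) → ind (lengthOne v) ≡ preimages v
  lengthOne-preimages v with lengthOne v in e
  ... | true with lengthOne-gen v e
  ...   | a , b , a<b , ntr∧eq =
    sym (trans (cong preimages (sym gen≡v)) (preimages-gen a b a<b (∧-trueˡ (nontrivial (a , b)) _ ntr∧eq)))
    where
    gen≡v : gen (a , b) ≡ v
    gen≡v = ==-sound (gen (a , b)) v (∧-trueʳ (nontrivial (a , b)) _ ntr∧eq)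
  lengthOne-preimages v | false = sym (countPairsFin-none N _ not-gen)
    where
    not-gen : ∀ a b → toℕ a < toℕ b → incidence (a , b) v ≡ false
    not-gen a b a<b with incidence (a , b) v in g
    ... | false = refl
    ... | true with () ← trans (sym e) (subst (λ w → lengthOne w ≡ true)
                                              (==-sound (gen (a , b)) v (∧-trueʳ (nontrivial (a , b)) _ g))
                                              (gen-lengthOne a b a<b (∧-trueˡ (nontrivial (a , b)) _ g)))

≡-dec-∷ : ∀ {n m} (a b : Fin n) (as bs : Vec (Fin n) m) →
          ⌊ ≡-dec _≟F_ (a ∷ as) (b ∷ bs) ⌋ ≡ (⌊ a ≟F b ⌋ ∧ ⌊ ≡-dec _≟F_ as bs ⌋)
≡-dec-∷ a b as bs with a ≟F b | ≡-dec _≟F_ as bs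
... | yes _ | yes _ = refl
... | yes _ | no _ = refl
... | no _ | yes _ = refl
... | no _ | no _ = refl

-- Every vector occurs exactly once in allVecs n m; the guarded form is needed
-- for the induction step and for the double count below.
mutual
  allVecs-once : ∀ n m (w : Vec (Fin n) m) → sumL (allVecs n m) (λ v → ind ⌊ ≡-dec _≟F_ w v ⌋) ≡ 1
  allVecs-once n zero [] = refl
  allVecs-once n (suc m) (w₀ ∷ ws) = begin
    sumL (allVecs n (suc m)) occurs
      ≡⟨ sumL-concatMap column (finList n) occurs ⟩
    sumL (finList n) (λ x → sumL (column x) occurs)
      ≡⟨ sumL-tabulate n (λ x → x) _ ⟩
    sumFin n (λ x → sumL (column x) occurs)
      ≡⟨ sumFin-cong n in-column ⟩
    sumFin n (λ x → ind ⌊ w₀ ≟F x ⌋)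
      ≡⟨ sumFin-countBelow n _ (λ q → q ≡ᵇ toℕ w₀) head-index ⟩
    countBelow n (λ q → q ≡ᵇ toℕ w₀)
      ≡⟨ countBelow-single n (toℕ w₀) (λ q → refl) (toℕ<n w₀) ⟩
    1 ∎
    where
    occurs : Vec (Fin n) (suc m) → ℕ
    occurs v = ind ⌊ ≡-dec _≟F_ (w₀ ∷ ws) v ⌋
    column : Fin n → List (Vec (Fin n) (suc m))
    column x = map (x ∷_) (allVecs n m)
    in-column : ∀ x → sumL (column x) occurs ≡ ind ⌊ w₀ ≟F x ⌋
    in-column x = trans (sumL-map (x ∷_) (allVecs n m) occurs)
      (trans (sumL-cong (allVecs n m) (λ vs → cong ind (≡-dec-∷ w₀ x ws vs)))
             (allVecs-once-guarded n m ws ⌊ w₀ ≟F x ⌋))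
    head-index : ∀ x → ⌊ w₀ ≟F x ⌋ ≡ (toℕ x ≡ᵇ toℕ w₀)
    head-index x = trans (≟F-toℕ w₀ x) (≡ᵇ-sym (toℕ w₀) (toℕ x))

  allVecs-once-guarded : ∀ n m (w : Vec (Fin n) m) b →
                         sumL (allVecs n m) (λ v → ind (b ∧ ⌊ ≡-dec _≟F_ w v ⌋)) ≡ ind b
  allVecs-once-guarded n m w true = allVecs-once n m w
  allVecs-once-guarded n m w false = sumL-zero (allVecs n m) (λ v → refl)

a-one-pairs : ∀ k → a (suc (suc k)) 1 ≡ countPairs (suc (suc k)) (λ x y → not ((x ≡ᵇ 0) ∧ (y ≡ᵇ 1)))
a-one-pairs k = begin
  a N 1
    ≡⟨ countᵇ-sumL lengthOne vecs ⟩
  sumL vecs (λ v → ind (lengthOne v))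
    ≡⟨ sumL-cong vecs (λ v → trans (lengthOne-preimages v) (sym (sumL-pairsLt N (λ a b → incidence (a , b) v)))) ⟩
  sumL vecs (λ v → sumL pairs (λ p → ind (incidence p v)))
    ≡⟨ sumL-swap vecs pairs (λ v p → ind (incidence p v)) ⟩
  sumL pairs (λ p → sumL vecs (λ v → ind (incidence p v)))
    ≡⟨ sumL-cong pairs (λ p → allVecs-once-guarded N N (gen p) (nontrivial p)) ⟩
  sumL pairs (λ p → ind (nontrivial p))
    ≡⟨ sumL-pairsLt N (λ a b → nontrivial (a , b)) ⟩
  countPairsFin N (λ a b → nontrivial (a , b))
    ≡⟨ countPairsFin-toℕ N _ (λ x y → not ((x ≡ᵇ 0) ∧ (y ≡ᵇ 1))) nontrivial-toℕ ⟩
  countPairs N (λ x y → not ((x ≡ᵇ 0) ∧ (y ≡ᵇ 1)))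
    ∎
  where
  open Generators k
  vecs : List (Perm N)
  vecs = allVecs N N
  pairs : List (Fin N × Fin N)
  pairs = pairsLt N

pairCount : ℕ → ℕ
pairCount m = countPairs m (λ _ _ → true)

pairCount-suc : ∀ m → pairCount (suc m) ≡ m + pairCount m
pairCount-suc m = cong (_+ pairCount m) (countBelow-all m)

-- a(k+2,1) = C(k+2,2) − 1: the pairs (0 , y) with y ≥ 2, then all pairs of {1,…,k+1}
a-one : ∀ k → a (suc (suc k)) 1 ≡ k + pairCount (suc k)
a-one k = trans (a-one-pairs k) (cong (_+ pairCount (suc k)) (countBelow-all k))

proposition5p2 : (n : ℕ) → 3 ≤ n → a n 1 ≡ a (n ∸ 1) 1 + (n ∸ 1)
proposition5p2 (suc (suc (suc k))) (s≤s (s≤s (s≤s z≤n))) = begin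
  a (3 + k) 1                            ≡⟨ a-one (suc k) ⟩
  suc k + pairCount (2 + k)              ≡⟨ cong (suc k +_) (pairCount-suc (suc k)) ⟩
  suc k + (suc k + pairCount (suc k))    ≡⟨ rearrange k (pairCount (suc k)) ⟩
  (k + pairCount (suc k)) + (2 + k)      ≡⟨ cong (_+ (2 + k)) (sym (a-one k)) ⟩
  a (2 + k) 1 + (2 + k)                  ∎
  where
  rearrange : ∀ m x → suc m + (suc m + x) ≡ (m + x) + suc (suc m)
  rearrange = solve-∀
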